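{- Let $\mathcal C$ be any collection of languages over a countably infinite universe $U$. Then $\mathcal C$ is uniformly noise-dependently generatable if and only if $\mathrm{NC}_1(\mathcal C) < \infty$.
   Context: A language is an infinite subset of $U$; a collection is a (possibly uncountable) set of languages. For $i \in \mathbb N=\{0,1,\dots\}$, an enumeration of a language $K$ with noise level $i$ is an infinite sequence $x_0, x_1, \dots$ of elements of $U$ without repetitions such that $K \subseteq \{x_j : j \in \mathbb N\}$ and $|\{x_j : j\in\mathbb N\} \setminus K| \le i$. Write $S_t = \{x_0,\dots,x_t\}$. A generator algorithm is a function $G : U^* \to U$; at time $t$ it outputs $z_t = G(x_0,\dots,x_t)$. An algorithm $G$ uniformly noise-dependently generates for $\mathcal C$ if for every noise level $n^\star \in \mathbb N$ there exists a time $t^\star$ such that for every $K \in \mathcal C$, every enumeration $x$ of $K$ with noise level $n^\star$, and all $t \ge t^\star$, $z_t \in K \setminus S_t$; $\mathcal C$ is uniformly noise-dependently generatable if such $G$ exists. For $S \subseteq U$, $\mathcal C(S,i) = \{L \in \mathcal C : |S\setminus L| \le i\}$; the noisy closure $\langle S\rangle_{\mathcal C,i}$ is $\bigcap_{L\in\mathcal C(S,i)} L$ if $\mathcal C(S,i)\neq\emptyset$ and $\emptyset$ otherwise. $\mathrm{NC}_i(\mathcal C)$ is the size of the largest finite set $S$ with $\mathcal C(S,i)\neq\emptyset$ and $|\langle S\rangle_{\mathcal C,i}|<\infty$, and $\infty$ if there are arbitrarily large such sets. -}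

module Defs where

open import Level using (Level)
open import Data.Nat using (ℕ; suc; _≤_)
open import Data.List using (List; length; map; upTo)
open import Data.List.Membership.Propositional using (_∈_; _∉_)
open import Data.List.Relation.Unary.All using (All)
open import Data.List.Relation.Unary.Unique.Propositional using (Unique)
open import Data.Product using (Σ; ∃; _×_)
open import Relation.Nullary using (¬_; Dec)
open import Relation.Binary.PropositionalEquality using (_≡_)

module _ {U : Set} where

  AtMost : ℕ → (U → Set) → Set
  AtMost i P = (xs : List U) → Unique xs → All P xs → length xs ≤ i

  Finite : (U → Set) → Set
  Finite P = Σ (List U) λ xs → (u : U) → P u → u ∈ xs

  Infinite : (U → Set) → Set
  Infinite P = (xs : List U) → Σ U λ u → P u × u ∉ xs

  Enumeration : (U → Set) → ℕ → (ℕ → U) → Set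
  Enumeration K i x =
      ((j k : ℕ) → x j ≡ x k → j ≡ k)
    × ((u : U) → K u → Σ ℕ λ j → x j ≡ u)
    × AtMost i (λ u → (Σ ℕ λ j → x j ≡ u) × ¬ K u)

  prefix : (ℕ → U) → ℕ → List U
  prefix x t = map x (upTo (suc t))

  output : (List U → U) → (ℕ → U) → ℕ → U
  output G x t = G (prefix x t)

  Collection : Set₁
  Collection = (U → Set) → Set

  UniformlyNoiseDependentlyGenerates : (List U → U) → Collection → Set₁
  UniformlyNoiseDependentlyGenerates G C =
    (n : ℕ) → Σ ℕ λ t⋆ →
      (K : U → Set) → C K → (x : ℕ → U) → Enumeration K n x →
      (t : ℕ) → t⋆ ≤ t → K (output G x t) × output G x t ∉ prefix x t

  UniformlyNoiseDependentlyGeneratable : Collection → Set₁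
  UniformlyNoiseDependentlyGeneratable C =
    Σ (List U → U) λ G → UniformlyNoiseDependentlyGenerates G C

  Fits : List U → ℕ → (U → Set) → Set
  Fits S i L = AtMost i (λ u → u ∈ S × ¬ L u)

  NonemptyC : Collection → List U → ℕ → Set₁
  NonemptyC C S i = Σ (U → Set) λ L → C L × Fits S i L

  -- noisy closure ⟨S⟩_{C,i}: intersection of C(S,i) if nonempty, ∅ otherwise
  NoisyClosure : Collection → List U → ℕ → U → Set₁
  NoisyClosure C S i u =
    NonemptyC C S i × ((L : U → Set) → C L → Fits S i L → L u)

  FiniteSet₁ : (U → Set₁) → Set₁
  FiniteSet₁ P = Σ (List U) λ xs → (u : U) → P u → u ∈ xs

  NC<∞ : Collection → ℕ → Set₁
  NC<∞ C i = Σ ℕ λ d → (S : List U) → Unique S → NonemptyC C S i →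
             FiniteSet₁ (NoisyClosure C S i) → length S ≤ d

  IsCollectionOfLanguages : Collection → Set₁
  IsCollectionOfLanguages C = (L : U → Set) → C L → Infinite L

ExcludedMiddle₁ : Set₂
ExcludedMiddle₁ = (P : Set₁) → Dec P

-- (⇒) Let t⋆ be the uniform time for noise level 1, and S duplicate-free with C(S,1) ≠ ∅ and
-- |S| > t⋆. A duplicate-free list P ⊆ S ∪ ⟨S⟩₁ longer than t⋆ misses at most one element of any
-- L ∈ C(S,1), so it is a prefix of a noise-1 enumeration of L; hence the output on P is a new
-- element of every such L, i.e. of ⟨S⟩₁. Feeding the generator its own outputs, starting from S,
-- never stops producing new elements of S ∪ ⟨S⟩₁, so ⟨S⟩₁ is infinite; thus |S| ≤ t⋆ whenever
-- ⟨S⟩₁ is finite.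
--
-- (⇐) Let NC₁(C) ≤ d. By induction on i there is D_i such that ⟨S⟩_i is infinite whenever
-- C(S,i) ≠ ∅ and |S| > D_i. For the step take L₀ ∈ C(S,i+1), cut S ∩ L₀ into d+1 blocks of
-- D_i+1 elements and pick a new point of the (infinite) closure of each block. A language missing
-- such a point misses more than i elements of its block, so each L ∈ C(S,i+1) misses at most one
-- of these d+1 points Y; then ⟨Y⟩₁ ⊆ ⟨S⟩_{i+1}, and ⟨Y⟩₁ is infinite because |Y| > d. The
-- generator outputs a new element of ⟨S⟩_j for the largest j ≤ |S| for which there is one; once
-- |S| > D_{n+1} this j exceeds the noise level n, so the target language lies in C(S,j).

module Submission where

open import Defs
open import Data.Nat using (ℕ)
open import Function.Bundles using (_↔_)
open import Data.Product using (_×_)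

open import Level using (Level; 0ℓ; Lift; lift; lower)
open import Function.Bundles using (module Inverse)
open import Function.Properties.Inverse using (↔⇒↣)
open import Data.Nat using (zero; suc; _+_; _*_; _∸_; _≤_; _<_; z≤n; s≤s; _≤?_; _≟_)
open import Data.Nat.Properties
open import Data.List using (List; []; _∷_; length; filter; map; upTo; applyUpTo; _++_; take; drop)
open import Data.List.Properties
  using (filter-notAll; filter-accept; filter-reject; filter-++; length-++; length-take; length-drop;
         take++drop≡id; length-map; length-upTo; map-upTo)
open import Data.List.Membership.Propositional using (_∈_; _∉_)
open import Data.List.Membership.Propositional.Properties
  using (∈-filter⁺; ∈-filter⁻; ∈-++⁺ˡ; ∈-++⁺ʳ; ∈-applyUpTo⁺; ∈-map⁻)
import Data.List.Membership.DecPropositional as DecMembership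
open import Data.List.Relation.Binary.Subset.Propositional using (_⊆_)
open import Data.List.Relation.Unary.All as All using (All; []; _∷_)
import Data.List.Relation.Unary.All.Properties as All
open import Data.List.Relation.Unary.Any as Any using (here; there)
open import Data.List.Relation.Unary.AllPairs using ([]; _∷_)
open import Data.List.Relation.Unary.Unique.Propositional using (Unique)
import Data.List.Relation.Unary.Unique.Propositional.Properties as Unique
open import Data.Product using (Σ; ∃-syntax; _,_; proj₁; proj₂; map₁)
open import Data.Sum using (_⊎_; inj₁; inj₂)
open import Relation.Nullary using (¬_; Dec; yes; no; contradiction; ¬?; _×-dec_)
open import Relation.Nullary.Decidable using (map′; via-injection)
open import Relation.Unary using (Pred; Decidable)
open import Relation.Unary.Properties using (∁?)
open import Relation.Binary.Definitions using (DecidableEquality; tri<; tri≈; tri>)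
open import Relation.Binary.PropositionalEquality
  using (_≡_; _≢_; refl; sym; trans; cong; subst; module ≡-Reasoning)

module _ {A : Set} where

  ∉⇒Unique-∷ : {x : A} {xs : List A} → x ∉ xs → Unique xs → Unique (x ∷ xs)
  ∉⇒Unique-∷ {xs = xs} x∉xs uxs = All.¬Any⇒All¬ xs x∉xs ∷ uxs

  length-take≡ : ∀ {n} (R : List A) → n ≤ length R → length (take n R) ≡ n
  length-take≡ {n} R n≤|R| = trans (length-take n R) (m≤n⇒m⊓n≡m n≤|R|)

  ≤-length-drop : ∀ {m} n (R : List A) → n + m ≤ length R → m ≤ length (drop n R)
  ≤-length-drop {m} n R n+m≤|R| =
    subst (m ≤_) (sym (length-drop n R)) (m+n≤o⇒m≤o∸n m (subst (_≤ length R) (+-comm n m) n+m≤|R|))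

  module _ {P : Pred A 0ℓ} (P? : Decidable P) where

    length-filter+length-filter-∁ : ∀ xs → length (filter P? xs) + length (filter (∁? P?) xs) ≡ length xs
    length-filter+length-filter-∁ [] = refl
    length-filter+length-filter-∁ (x ∷ xs) with P? x
    ... | yes _ = cong suc (length-filter+length-filter-∁ xs)
    ... | no _ = trans (+-suc _ _) (cong suc (length-filter+length-filter-∁ xs))

  module _ (_≟_ : DecidableEquality A) where

    Unique∧⊆⇒length≤ : {xs ys : List A} → Unique xs → xs ⊆ ys → length xs ≤ length ys
    Unique∧⊆⇒length≤ {[]} _ _ = z≤n
    Unique∧⊆⇒length≤ {x ∷ xs} {ys} (x≢xs ∷ uxs) x∷xs⊆ys =
      ≤-trans (s≤s (Unique∧⊆⇒length≤ uxs xs⊆ys-x))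
              (filter-notAll (x≢?_) ys (Any.map (λ x≡y x≢y → x≢y x≡y) (x∷xs⊆ys (here refl))))
      where
      x≢?_ : Decidable (x ≢_)
      x≢? y = ¬? (x ≟ y)
      xs⊆ys-x : xs ⊆ filter (x≢?_) ys
      xs⊆ys-x y∈xs = ∈-filter⁺ (x≢?_) (x∷xs⊆ys (there y∈xs)) (All.lookup x≢xs y∈xs)

    module _ {ℓ : Level} (Q : A → Set ℓ) (fresh : List A → A) (S : List A)
             (grow : ∀ P → Unique P → All Q P → length S ≤ length P →
                     Q (fresh P) × fresh P ∉ P) where

      iterate-fresh : Unique S → All Q S →
                      ∀ j → Σ (List A) λ P → Unique P × All Q P × length P ≡ j + length S
      iterate-fresh uS QS zero = S , uS , QS , refl
      iterate-fresh uS QS (suc j) with P , uP , QP , |P| ← iterate-fresh uS QS j =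
        let (Qp , p∉P) = grow P uP QP (≤-trans (m≤n+m _ j) (≤-reflexive (sym |P|)))
        in fresh P ∷ P , ∉⇒Unique-∷ p∉P uP , Qp ∷ QP , cong suc |P|

      fresh⇒¬finite : Unique S → All Q S → (F : List A) → ¬ (∀ u → Q u → u ∈ F)
      fresh⇒¬finite uS QS F covers with P , uP , QP , |P| ← iterate-fresh uS QS (suc (length F)) =
        <⇒≱ (≤-trans (s≤s (m≤m+n (length F) (length S))) (≤-reflexive (sym |P|)))
            (Unique∧⊆⇒length≤ uP (λ u∈P → covers _ (All.lookup QP u∈P)))

module _ {U : Set} where

  AtMost-mono : ∀ {i j} {P Q : U → Set} → i ≤ j → (∀ u → Q u → P u) → AtMost i P → AtMost j Q
  AtMost-mono i≤j Q⇒P atMost xs uxs Qxs = ≤-trans (atMost xs uxs (All.map (Q⇒P _) Qxs)) i≤j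

  module _ {P : U → Set} (P? : Decidable P) where

    AtMost⇒length-filter≤ : ∀ {i xs} → Unique xs → AtMost i (λ u → u ∈ xs × P u) →
                            length (filter P? xs) ≤ i
    AtMost⇒length-filter≤ {xs = xs} uxs atMost =
      atMost (filter P? xs) (Unique.filter⁺ P? uxs) (All.tabulate (∈-filter⁻ P?))

    length-filter≤⇒AtMost : DecidableEquality U → ∀ {i xs} → length (filter P? xs) ≤ i →
                            AtMost i (λ u → u ∈ xs × P u)
    length-filter≤⇒AtMost _≟_ {xs = xs} ≤i ys uys Pys = ≤-trans (Unique∧⊆⇒length≤ _≟_ uys ys⊆filter) ≤i
      where
      ys⊆filter : ys ⊆ filter P? xs
      ys⊆filter y∈ys = let (y∈xs , Py) = All.lookup Pys y∈ys in ∈-filter⁺ P? y∈xs Py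

module _ {P : Pred ℕ 0ℓ} (P? : Decidable P) where

  Least≥ : ℕ → ℕ → Set
  Least≥ lo r = P r × lo ≤ r × (∀ {n} → lo ≤ n → P n → r ≤ n)

  least≥ : ∀ k lo → P (k + lo) → Σ ℕ (Least≥ lo)
  least≥ k lo Pk+lo with P? lo
  ... | yes Plo = lo , Plo , ≤-refl , λ lo≤n _ → lo≤n
  least≥ zero lo Plo | no ¬Plo = contradiction Plo ¬Plo
  least≥ (suc k) lo Pk+lo | no ¬Plo =
    let (r , Pr , lo<r , least) = least≥ k (suc lo) (subst P (sym (+-suc k lo)) Pk+lo)
        lo<n : ∀ {n} → lo ≤ n → P n → suc lo ≤ n
        lo<n lo≤n Pn = ≤∧≢⇒< lo≤n (λ lo≡n → ¬Plo (subst P (sym lo≡n) Pn))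
    in r , Pr , <⇒≤ lo<r , λ lo≤n Pn → least (lo<n lo≤n Pn) Pn

  module _ (unbounded : ∀ lo → ∃[ n ] lo ≤ n × P n) where

    leastFrom : ∀ lo → Σ ℕ (Least≥ lo)
    leastFrom lo =
      let (n , lo≤n , Pn) = unbounded lo in least≥ (n ∸ lo) lo (subst P (sym (m∸n+n≡m lo≤n)) Pn)

    next : ℕ → ℕ
    next lo = proj₁ (leastFrom lo)

    next-least : ∀ lo → Least≥ lo (next lo)
    next-least lo = proj₂ (leastFrom lo)

    enumerate : ℕ → ℕ
    enumerate zero = next zero
    enumerate (suc j) = next (suc (enumerate j))

    enumerate-sound : ∀ j → P (enumerate j)
    enumerate-sound zero = proj₁ (next-least zero)
    enumerate-sound (suc j) = proj₁ (next-least (suc (enumerate j)))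

    enumerate-<-suc : ∀ j → enumerate j < enumerate (suc j)
    enumerate-<-suc j = proj₁ (proj₂ (next-least (suc (enumerate j))))

    enumerate-strictMono : ∀ {i j} → i < j → enumerate i < enumerate j
    enumerate-strictMono {i} {suc j} (s≤s i≤j) with m≤n⇒m<n∨m≡n i≤j
    ... | inj₁ i<j = <-trans (enumerate-strictMono i<j) (enumerate-<-suc j)
    ... | inj₂ refl = enumerate-<-suc j

    enumerate-injective : ∀ {i j} → enumerate i ≡ enumerate j → i ≡ j
    enumerate-injective {i} {j} eq with <-cmp i j
    ... | tri< i<j _ _ = contradiction eq (<⇒≢ (enumerate-strictMono i<j))
    ... | tri≈ _ i≡j _ = i≡j
    ... | tri> _ _ j<i = contradiction (sym eq) (<⇒≢ (enumerate-strictMono j<i))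

    j≤enumerate : ∀ j → j ≤ enumerate j
    j≤enumerate zero = z≤n
    j≤enumerate (suc j) = ≤-trans (s≤s (j≤enumerate j)) (enumerate-<-suc j)

    enumerate-complete : ∀ {n} → P n → ∃[ j ] enumerate j ≡ n
    enumerate-complete {n} Pn = below n (j≤enumerate n)
      where
      below : ∀ j → n ≤ enumerate j → ∃[ i ] enumerate i ≡ n
      below zero n≤e = zero , ≤-antisym (proj₂ (proj₂ (next-least zero)) z≤n Pn) n≤e
      below (suc j) n≤e with n ≤? enumerate j
      ... | yes n≤e′ = below j n≤e′
      ... | no n≰e′ =
        suc j , ≤-antisym (proj₂ (proj₂ (next-least (suc (enumerate j)))) (≰⇒> n≰e′) Pn) n≤e

module _ {A : Set} where

  prepend : List A → (ℕ → A) → ℕ → A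
  prepend [] f j = f j
  prepend (a ∷ P) f zero = a
  prepend (a ∷ P) f (suc j) = prepend P f j

  applyUpTo-prepend : ∀ P f → applyUpTo (prepend P f) (length P) ≡ P
  applyUpTo-prepend [] f = refl
  applyUpTo-prepend (a ∷ P) f = cong (a ∷_) (applyUpTo-prepend P f)

  prepend-length+ : ∀ P f n → prepend P f (length P + n) ≡ f n
  prepend-length+ [] f n = refl
  prepend-length+ (a ∷ P) f n = prepend-length+ P f n

  prepend-∈ : ∀ P f {u} → u ∈ P → ∃[ j ] prepend P f j ≡ u
  prepend-∈ (a ∷ P) f (here refl) = zero , refl
  prepend-∈ (a ∷ P) f (there u∈P) = let (j , eq) = prepend-∈ P f u∈P in suc j , eq

  prepend-cases : ∀ P f j → prepend P f j ∈ P ⊎ ∃[ n ] prepend P f j ≡ f n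
  prepend-cases [] f j = inj₂ (j , refl)
  prepend-cases (a ∷ P) f zero = inj₁ (here refl)
  prepend-cases (a ∷ P) f (suc j) with prepend-cases P f j
  ... | inj₁ ∈P = inj₁ (there ∈P)
  ... | inj₂ eq = inj₂ eq

  module _ (f : ℕ → A) (f-injective : ∀ {m n} → f m ≡ f n → m ≡ n) where

    prepend-≢-head : ∀ {a} P → a ∉ P → (∀ n → f n ≢ a) → ∀ j → prepend P f j ≢ a
    prepend-≢-head P a∉P f≢a j with prepend-cases P f j
    ... | inj₁ ∈P = λ eq → a∉P (subst (_∈ P) eq ∈P)
    ... | inj₂ (n , eq) = λ eq′ → f≢a n (trans (sym eq) eq′)

    prepend-injective : ∀ P → Unique P → (∀ n → f n ∉ P) →
                        ∀ {i j} → prepend P f i ≡ prepend P f j → i ≡ j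
    prepend-injective [] _ _ eq = f-injective eq
    prepend-injective (a ∷ P) _ _ {zero} {zero} _ = refl
    prepend-injective (a ∷ P) (a≢P ∷ uP) f∉ {zero} {suc j} eq =
      contradiction (sym eq) (prepend-≢-head P (All.All¬⇒¬Any a≢P) (λ n eq → f∉ n (here eq)) j)
    prepend-injective (a ∷ P) (a≢P ∷ uP) f∉ {suc i} {zero} eq =
      contradiction eq (prepend-≢-head P (All.All¬⇒¬Any a≢P) (λ n eq → f∉ n (here eq)) i)
    prepend-injective (a ∷ P) (_ ∷ uP) f∉ {suc i} {suc j} eq =
      cong suc (prepend-injective P uP (λ n ∈P → f∉ n (there ∈P)) eq)

module _ {U : Set} (bij : U ↔ ℕ) where

  open Inverse bij using (to; from; strictlyInverseˡ; strictlyInverseʳ)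

  ≡-dec-from-↔ℕ : DecidableEquality U
  ≡-dec-from-↔ℕ = via-injection (↔⇒↣ bij) _≟_

  open DecMembership ≡-dec-from-↔ℕ using (_∈?_; _∉?_)

  from-injective : ∀ {m n} → from m ≡ from n → m ≡ n
  from-injective {m} {n} eq = trans (sym (strictlyInverseˡ m)) (trans (cong to eq) (strictlyInverseˡ n))

  module _ {L : U → Set} (L? : Decidable L) (infinite : Infinite L) (P : List U) where

    FreshCode : Pred ℕ 0ℓ
    FreshCode n = L (from n) × from n ∉ P

    freshCode-unbounded : ∀ lo → ∃[ n ] lo ≤ n × FreshCode n
    freshCode-unbounded lo with u , Lu , u∉ ← infinite (P ++ applyUpTo from lo) =
      to u , lo≤ , subst L (sym (strictlyInverseʳ u)) Lu ,
      (λ ∈P → u∉ (∈-++⁺ˡ (subst (_∈ P) (strictlyInverseʳ u) ∈P)))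
      where
      lo≤ : lo ≤ to u
      lo≤ = ≮⇒≥ λ to-u<lo →
        u∉ (∈-++⁺ʳ P (subst (_∈ applyUpTo from lo) (strictlyInverseʳ u) (∈-applyUpTo⁺ from to-u<lo)))

    freshCode? : Decidable FreshCode
    freshCode? n = L? (from n) ×-dec (from n ∉? P)

    freshElement : ℕ → U
    freshElement n = from (enumerate freshCode? freshCode-unbounded n)

    freshElement-sound : ∀ n → L (freshElement n) × freshElement n ∉ P
    freshElement-sound n = enumerate-sound freshCode? freshCode-unbounded n

    freshElement-injective : ∀ {m n} → freshElement m ≡ freshElement n → m ≡ n
    freshElement-injective eq = enumerate-injective freshCode? freshCode-unbounded (from-injective eq)

    freshElement-complete : ∀ {u} → L u → u ∉ P → ∃[ n ] freshElement n ≡ u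
    freshElement-complete {u} Lu u∉P =
      let code-fresh = subst L (sym (strictlyInverseʳ u)) Lu , subst (_∉ P) (sym (strictlyInverseʳ u)) u∉P
          (n , eq) = enumerate-complete freshCode? freshCode-unbounded code-fresh
      in n , trans (cong from eq) (strictlyInverseʳ u)

  prefix-extends-to-enumeration : ∀ {L i t} → Decidable L → Infinite L →
                                  (P : List U) → Unique P → Fits P i L → length P ≡ suc t →
                                  Σ (ℕ → U) λ x → Enumeration L i x × prefix x t ≡ P
  prefix-extends-to-enumeration {L} {i} {t} L? infinite P uP fits |P| =
    x , ((λ _ _ → x-injective) , x-covers , AtMost-mono ≤-refl noise∈P fits) , x-prefix
    where
    f = freshElement L? infinite P
    x = prepend P f
    x-injective : ∀ {i j} → x i ≡ x j → i ≡ j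
    x-injective = prepend-injective f (freshElement-injective L? infinite P) P uP
                    (λ n → proj₂ (freshElement-sound L? infinite P n))
    x-covers : ∀ u → L u → ∃[ j ] x j ≡ u
    x-covers u Lu with u ∈? P
    ... | yes u∈P = prepend-∈ P f u∈P
    ... | no u∉P = let (n , eq) = freshElement-complete L? infinite P Lu u∉P
                   in length P + n , trans (prepend-length+ P f n) eq
    noise∈P : ∀ u → (∃[ j ] x j ≡ u) × ¬ L u → u ∈ P × ¬ L u
    noise∈P u ((j , eq) , ¬Lu) with prepend-cases P f j
    ... | inj₁ ∈P = subst (_∈ P) eq ∈P , ¬Lu
    ... | inj₂ (n , eq′) =
      contradiction (subst L (trans (sym eq′) eq) (proj₁ (freshElement-sound L? infinite P n))) ¬Lu
    x-prefix : prefix x t ≡ P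
    x-prefix = trans (map-upTo x (suc t)) (trans (cong (applyUpTo x) (sym |P|)) (applyUpTo-prepend P f))

module _ {U : Set} where

  length-prefix : ∀ x t → length (prefix {U} x t) ≡ suc t
  length-prefix x t = trans (length-map x (upTo (suc t))) (length-upTo (suc t))

  prefix-unique : ∀ {x} → (∀ j k → x j ≡ x k → j ≡ k) → ∀ t → Unique (prefix {U} x t)
  prefix-unique x-injective t = Unique.map⁺ (x-injective _ _) (Unique.upTo⁺ (suc t))

  prefix-fits : ∀ {K n x} → Enumeration K n x → ∀ t → Fits (prefix x t) n K
  prefix-fits {x = x} (_ , _ , noise) t = AtMost-mono ≤-refl (λ u (u∈S , ¬Ku) → index u∈S , ¬Ku) noise
    where
    index : {u : U} → u ∈ prefix x t → ∃[ j ] x j ≡ u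
    index u∈S = let (j , _ , eq) = ∈-map⁻ x u∈S in j , sym eq

  Fits-mono : ∀ {S i j} {L : U → Set} → i ≤ j → Fits S i L → Fits S j L
  Fits-mono i≤j = AtMost-mono i≤j (λ _ u∈S∖L → u∈S∖L)

  Fits-⊆ : ∀ {S S′ i} {L : U → Set} → S′ ⊆ S → Fits S i L → Fits S′ i L
  Fits-⊆ S′⊆S = AtMost-mono ≤-refl (λ _ (u∈S′ , ¬Lu) → S′⊆S u∈S′ , ¬Lu)

  All⇒Fits : ∀ {S i} {L : U → Set} → All L S → Fits S i L
  All⇒Fits LS [] _ _ = z≤n
  All⇒Fits LS (_ ∷ _) _ ((u∈S , ¬Lu) ∷ _) = contradiction (All.lookup LS u∈S) ¬Lu

  InfiniteSet₁ : (U → Set₁) → Set₁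
  InfiniteSet₁ Q = (xs : List U) → Σ U λ u → Q u × u ∉ xs

  module _ (C : Collection {U}) where

    NoisyClosure-antitone : ∀ {S Y i j} → NonemptyC C S i → (∀ {L} → C L → Fits S i L → Fits Y j L) →
                            ∀ {u} → NoisyClosure C Y j u → NoisyClosure C S i u
    NoisyClosure-antitone nonempty S⇒Y (_ , in-all) = nonempty , λ L CL fits → in-all L CL (S⇒Y CL fits)

    NCBound : ℕ → ℕ → Set₁
    NCBound i d =
      (S : List U) → Unique S → NonemptyC C S i → FiniteSet₁ (NoisyClosure C S i) → length S ≤ d

    ClosuresInfiniteAbove : ℕ → ℕ → Set₁
    ClosuresInfiniteAbove i D =
      ∀ S → Unique S → D < length S → NonemptyC C S i → InfiniteSet₁ (NoisyClosure C S i)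

    FreshInClosure : List U → ℕ → Set₁
    FreshInClosure S i = Σ U λ z → NoisyClosure C S i z × z ∉ S

decide : ExcludedMiddle₁ → (P : Set) → Dec P
decide em P = map′ lower lift (em (Lift _ P))

module _ (em : ExcludedMiddle₁) {U : Set} (bij : U ↔ ℕ) (C : Collection {U}) where

  open DecMembership (≡-dec-from-↔ℕ bij) using (_∈?_)

  decidable : (L : U → Set) → Decidable L
  decidable L u = decide em (L u)

  module _ (languages : IsCollectionOfLanguages C) {i t⋆ : ℕ} {G : List U → U}
           (generates : (K : U → Set) → C K → (x : ℕ → U) → Enumeration K i x →
                        (t : ℕ) → t⋆ ≤ t → K (output G x t) × output G x t ∉ prefix x t) where

    output-in-closure : ∀ {S P} → NonemptyC C S i → Unique P → All (λ u → u ∈ S ⊎ NoisyClosure C S i u) P →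
                        t⋆ < length P → NoisyClosure C S i (G P) × G P ∉ P
    output-in-closure {S} {P} nonempty@(L₀ , CL₀ , fits₀) uP P⊆S∪closure t⋆<|P| =
      (nonempty , λ L CL fits → proj₁ (output-fresh L CL fits refl t⋆<|P|)) ,
      proj₂ (output-fresh L₀ CL₀ fits₀ refl t⋆<|P|)
      where
      output-fresh : ∀ L → C L → Fits S i L → ∀ {n} → length P ≡ n → t⋆ < n → L (G P) × G P ∉ P
      output-fresh L CL fits {suc t} |P| (s≤s t⋆≤t) =
        let (x , enumeration , x-prefix) =
              prefix-extends-to-enumeration bij (decidable L) (languages L CL) P uP P-fits |P|
        in subst (λ Q → L (G Q) × G Q ∉ Q) x-prefix (generates L CL x enumeration t t⋆≤t)
        where
        missed∈S : ∀ u → u ∈ P × ¬ L u → u ∈ S × ¬ L u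
        missed∈S u (u∈P , ¬Lu) with All.lookup P⊆S∪closure u∈P
        ... | inj₁ u∈S = u∈S , ¬Lu
        ... | inj₂ (_ , in-all) = contradiction (in-all L CL fits) ¬Lu
        P-fits : Fits P i L
        P-fits = AtMost-mono ≤-refl missed∈S fits

    generates⇒NC<∞ : NC<∞ C i
    generates⇒NC<∞ = t⋆ , λ S uS nonempty (F , F-covers) → ≮⇒≥ λ t⋆<|S| →
      fresh⇒¬finite (≡-dec-from-↔ℕ bij) (λ u → u ∈ S ⊎ NoisyClosure C S i u) G S
        (λ P uP P⊆ |S|≤|P| →
           map₁ inj₂ (output-in-closure nonempty uP P⊆ (<-≤-trans t⋆<|S| |S|≤|P|)))
        uS (All.tabulate inj₁) (S ++ F)
        λ { u (inj₁ u∈S) → ∈-++⁺ˡ u∈S ; u (inj₂ u∈closure) → ∈-++⁺ʳ S (F-covers u u∈closure) }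

  _∩_ : List U → (U → Set) → List U
  R ∩ L = filter (decidable L) R

  _∖_ : List U → (U → Set) → List U
  R ∖ L = filter (∁? (decidable L)) R

  Fits⇒length∖≤ : ∀ {S i L} → Unique S → Fits S i L → length (S ∖ L) ≤ i
  Fits⇒length∖≤ {L = L} = AtMost⇒length-filter≤ (∁? (decidable L))

  length∖≤⇒Fits : ∀ {S i L} → length (S ∖ L) ≤ i → Fits S i L
  length∖≤⇒Fits {L = L} = length-filter≤⇒AtMost (∁? (decidable L)) (≡-dec-from-↔ℕ bij)

  Fits⇒≤length∩ : ∀ {S i m L} → Unique S → Fits S i L → m + i ≤ length S → m ≤ length (S ∩ L)
  Fits⇒≤length∩ {S} {i} {m} {L} uS fits m+i≤|S| = +-cancelʳ-≤ i m _ (begin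
    m + i                          ≤⟨ m+i≤|S| ⟩
    length S                       ≡⟨ sym (length-filter+length-filter-∁ (decidable L) S) ⟩
    length (S ∩ L) + length (S ∖ L) ≤⟨ +-monoʳ-≤ (length (S ∩ L)) (Fits⇒length∖≤ uS fits) ⟩
    length (S ∩ L) + i             ∎)
    where open ≤-Reasoning

  ¬finite⇒infinite : ∀ {Q} → ¬ FiniteSet₁ Q → InfiniteSet₁ Q
  ¬finite⇒infinite {Q} ¬finite xs with em (Σ U λ u → Q u × u ∉ xs)
  ... | yes fresh = fresh
  ... | no ¬fresh = contradiction (xs , covers) ¬finite
    where
    covers : ∀ u → Q u → u ∈ xs
    covers u Qu with u ∈? xs
    ... | yes u∈xs = u∈xs
    ... | no u∉xs = contradiction (u , Qu , u∉xs) ¬fresh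

  module _ {i D : ℕ} (infiniteAbove : ClosuresInfiniteAbove C i D) {L₀ : U → Set} (CL₀ : C L₀) where

    closurePoint : ∀ {W} → Unique W → All L₀ W → D < length W → (Y : List U) →
                   Σ U λ p → p ∉ Y × (∀ L → C L → ¬ L p → suc i ≤ length (W ∖ L))
    closurePoint {W} uW W⊆L₀ D<|W| Y
      with p , (_ , in-all) , p∉Y ← infiniteAbove W uW D<|W| (L₀ , CL₀ , All⇒Fits W⊆L₀) Y =
      p , p∉Y , λ L CL ¬Lp → ≰⇒> λ |W∖L|≤i → ¬Lp (in-all L CL (length∖≤⇒Fits |W∖L|≤i))

    closurePoints : ∀ r R → Unique R → All L₀ R → r * suc D ≤ length R →
                    Σ (List U) λ Y → Unique Y × length Y ≡ r ×
                                     (∀ L → C L → length (Y ∖ L) * suc i ≤ length (R ∖ L))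
    closurePoints zero R _ _ _ = [] , [] , refl , λ _ _ → z≤n
    closurePoints (suc r) R uR R⊆L₀ |R|≥
      with Y , uY , |Y| , Y-sparse ← closurePoints r (drop (suc D) R) (Unique.drop⁺ (suc D) uR)
                                       (All.drop⁺ (suc D) R⊆L₀) (≤-length-drop (suc D) R |R|≥)
      with p , p∉Y , p-heavy ← closurePoint (Unique.take⁺ (suc D) uR) (All.take⁺ (suc D) R⊆L₀)
                                 (≤-reflexive (sym (length-take≡ R (m+n≤o⇒m≤o (suc D) |R|≥)))) Y =
      p ∷ Y , ∉⇒Unique-∷ p∉Y uY , cong suc |Y| , invariant
      where
      block = take (suc D) R
      rest = drop (suc D) R
      split : ∀ L → length (R ∖ L) ≡ length (block ∖ L) + length (rest ∖ L)
      split L = begin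
        length (R ∖ L)                         ≡⟨ cong (λ R′ → length (R′ ∖ L)) (take++drop≡id (suc D) R) ⟨
        length ((block ++ rest) ∖ L)           ≡⟨ cong length (filter-++ (∁? (decidable L)) block rest) ⟩
        length (block ∖ L ++ rest ∖ L)         ≡⟨ length-++ (block ∖ L) ⟩
        length (block ∖ L) + length (rest ∖ L) ∎
        where open ≡-Reasoning
      invariant : ∀ L → C L → length ((p ∷ Y) ∖ L) * suc i ≤ length (R ∖ L)
      invariant L CL with decidable L p
      ... | yes Lp rewrite filter-reject (∁? (decidable L)) {p} {Y} (λ ¬Lp → ¬Lp Lp) =
        ≤-trans (Y-sparse L CL) (≤-trans (m≤n+m _ _) (≤-reflexive (sym (split L))))
      ... | no ¬Lp rewrite filter-accept (∁? (decidable L)) {p} {Y} ¬Lp =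
        ≤-trans (+-mono-≤ (p-heavy L CL ¬Lp) (Y-sparse L CL)) (≤-reflexive (sym (split L)))

  closuresInfiniteAbove-suc : ∀ {d i D} → NCBound C 1 d → ClosuresInfiniteAbove C i D →
                              ClosuresInfiniteAbove C (suc i) (suc d * suc D + suc i)
  closuresInfiniteAbove-suc {d} {i} {D} bound infiniteAbove S uS |S|> nonempty@(L₀ , CL₀ , S-fits-L₀)
    with Y , uY , |Y| , Y-sparse ← closurePoints infiniteAbove CL₀ (suc d) (S ∩ L₀)
                                     (Unique.filter⁺ (decidable L₀) uS) (All.all-filter (decidable L₀) S)
                                     (Fits⇒≤length∩ uS S-fits-L₀ (<⇒≤ |S|>)) =
    ¬finite⇒infinite λ (xs , covers) →
      <⇒≱ (≤-reflexive (sym |Y|))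
          (bound Y uY (L₀ , CL₀ , Y-fits CL₀ S-fits-L₀)
                 (xs , λ u u∈closure → covers u (NoisyClosure-antitone C nonempty Y-fits u∈closure)))
    where
    Y-fits : ∀ {L} → C L → Fits S (suc i) L → Fits Y 1 L
    Y-fits {L} CL S-fits = length∖≤⇒Fits (*-cancelʳ-≤ _ 1 (suc i) (begin
      length (Y ∖ L) * suc i  ≤⟨ Y-sparse L CL ⟩
      length ((S ∩ L₀) ∖ L)   ≤⟨ Fits⇒length∖≤ (Unique.filter⁺ (decidable L₀) uS)
                                   (Fits-⊆ (λ u∈S∩L₀ → proj₁ (∈-filter⁻ (decidable L₀) u∈S∩L₀)) S-fits) ⟩
      suc i                   ≡⟨ +-identityʳ (suc i) ⟨
      1 * suc i               ∎))
      where open ≤-Reasoning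

  closuresInfiniteAbove : NC<∞ C 1 → ∀ k → ∃[ D ] ClosuresInfiniteAbove C (suc k) D
  closuresInfiniteAbove (d , bound) zero =
    d , λ S uS d<|S| nonempty → ¬finite⇒infinite λ finite → <⇒≱ d<|S| (bound S uS nonempty finite)
  closuresInfiniteAbove nc@(d , bound) (suc k) with D , infiniteAbove ← closuresInfiniteAbove nc k =
    suc d * suc D + suc (suc k) , closuresInfiniteAbove-suc bound infiniteAbove

  -- `from zero` is a junk value, returned only when no closure of level ≤ i has a fresh element.
  pick : List U → ℕ → U
  pick S i with em (FreshInClosure C S i)
  ... | yes (z , _) = z
  pick S zero | no _ = Inverse.from bij zero
  pick S (suc i) | no _ = pick S i

  pick-sound : ∀ {S K n} i → n ≤ i → FreshInClosure C S n → C K → Fits S n K →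
               K (pick S i) × pick S i ∉ S
  pick-sound {S} i n≤i fresh CK fits with em (FreshInClosure C S i)
  ... | yes (z , (_ , in-all) , z∉S) = in-all _ CK (Fits-mono n≤i fits) , z∉S
  pick-sound zero z≤n fresh CK fits | no ¬fresh = contradiction fresh ¬fresh
  pick-sound (suc i) n≤1+i fresh CK fits | no ¬fresh with m≤n⇒m<n∨m≡n n≤1+i
  ... | inj₁ (s≤s n≤i) = pick-sound i n≤i fresh CK fits
  ... | inj₂ refl = contradiction fresh ¬fresh

  generator : List U → U
  generator S = pick S (length S)

  NC<∞⇒generates : NC<∞ C 1 → UniformlyNoiseDependentlyGenerates generator C
  NC<∞⇒generates nc n with D , infiniteAbove ← closuresInfiniteAbove nc n =
    D + n , λ K CK x enumeration@(x-injective , _) t D+n≤t →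
      let S = prefix x t
          |S| = length-prefix x t
          S-fits = Fits-mono (n≤1+n n) (prefix-fits enumeration t)
          fresh = infiniteAbove S (prefix-unique x-injective t)
                    (subst (D <_) (sym |S|) (s≤s (m+n≤o⇒m≤o D D+n≤t))) (K , CK , S-fits) S
      in pick-sound (length S) (subst (suc n ≤_) (sym |S|) (s≤s (m+n≤o⇒n≤o D D+n≤t))) fresh CK S-fits

mainTheorem3 : ExcludedMiddle₁ → (U : Set) → U ↔ ℕ → (C : Collection {U}) →
                 IsCollectionOfLanguages C →
                 (UniformlyNoiseDependentlyGeneratable C → NC<∞ C 1)
                 × (NC<∞ C 1 → UniformlyNoiseDependentlyGeneratable C)
mainTheorem3 em U bij C languages =
    (λ (G , generates) → generates⇒NC<∞ em bij C languages {G = G} (proj₂ (generates 1)))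
  , (λ nc → generator em bij C , NC<∞⇒generates em bij C nc)
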